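{- For every formula $\varphi$ we have $\varphi\in[\![\varphi]\!]\subseteq D(\varphi)$, where the leftmost $\varphi$ denotes the bunch consisting of the single leaf $\varphi$.
   Context: Formulas of BI: $\varphi,\psi ::= \top \mid \bot \mid \varphi\wedge\psi \mid \varphi\vee\psi \mid \varphi\to\psi \mid \mathsf{emp} \mid \varphi * \psi \mid \varphi \mathrel{ -\!\!*} \psi \mid a$ ($a\in\mathrm{Atom}$). Bunches: $\Delta ::= \varphi \mid \varnothing_m \mid \varnothing_a \mid \Delta , \Delta \mid \Delta ; \Delta$. A bunched context $\Delta(-)$ is a bunch with one hole; $\Delta(\Gamma)$ fills it. Bunch equivalence $\equiv$: least equivalence relation, closed under bunched contexts, making "$,$" commutative and associative with unit $\varnothing_m$ and "$;$" commutative and associative with unit $\varnothing_a$. The BI sequent calculus: (ax) $a\vdash a$; (equiv) from $\Delta'\vdash\varphi$, $\Delta\equiv\Delta'$ infer $\Delta\vdash\varphi$; (W;) from $\Delta(\Delta_1)\vdash\varphi$ infer $\Delta(\Delta_1;\Delta_2)\vdash\varphi$; (C;) from $\Delta(\Delta_1;\Delta_1)\vdash\varphi$ infer $\Delta(\Delta_1)\vdash\varphi$; (cut) from $\Delta'\vdash A$, $\Delta(A)\vdash B$ infer $\Delta(\Delta')\vdash B$; (empR) $\varnothing_m\vdash\mathsf{emp}$; (empL) from $\Delta(\varnothing_m)\vdash\varphi$ infer $\Delta(\mathsf{emp})\vdash\varphi$; (*R) from $\Delta_1\vdash\varphi$, $\Delta_2\vdash\psi$ infer $\Delta_1,\Delta_2\vdash\varphi*\psi$;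 (*L) from $\Delta(\varphi,\psi)\vdash\chi$ infer $\Delta(\varphi*\psi)\vdash\chi$; ($-\!*$R) from $\Delta,\varphi\vdash\psi$ infer $\Delta\vdash\varphi\mathrel{ -\!\!*}\psi$; ($-\!*$L) from $\Delta_1\vdash\varphi$, $\Delta(\Delta_2,\psi)\vdash\chi$ infer $\Delta((\Delta_1,\Delta_2),\varphi\mathrel{ -\!\!*}\psi)\vdash\chi$; ($\top$R) $\varnothing_a\vdash\top$; ($\top$L) from $\Delta(\varnothing_a)\vdash\varphi$ infer $\Delta(\top)\vdash\varphi$; ($\wedge$R) from $\Delta_1\vdash\varphi$, $\Delta_2\vdash\psi$ infer $\Delta_1;\Delta_2\vdash\varphi\wedge\psi$; ($\wedge$L) from $\Delta(\varphi;\psi)\vdash\chi$ infer $\Delta(\varphi\wedge\psi)\vdash\chi$; ($\to$R) from $\Delta;\varphi\vdash\psi$ infer $\Delta\vdash\varphi\to\psi$; ($\to$L) from $\Delta_1\vdash\varphi$, $\Delta(\Delta_2;\psi)\vdash\chi$ infer $\Delta((\Delta_1;\Delta_2);\varphi\to\psi)\vdash\chi$; ($\bot$L) $\Delta(\bot)\vdash\varphi$; ($\vee$R1/2) from $\Delta\vdash\varphi$ (resp. $\Delta\vdash\psi$) infer $\Delta\vdash\varphi\vee\psi$; ($\vee$L) from $\Delta(\varphi)\vdash\chi$, $\Delta(\psi)\vdash\chi$ infer $\Delta(\varphi\vee\psi)\vdash\chi$. $\Delta\vdash_{\mathsf{cf}}\varphi$ means derivable without (cut). Let $\mathrm{Bunch}$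 be the set of bunches modulo $\equiv$. For a formula $\varphi$ let $D(\varphi)=\{\Delta\in\mathrm{Bunch}\mid \Delta\vdash_{\mathsf{cf}}\varphi\}$. For $X\subseteq\mathrm{Bunch}$ let $\mathrm{cl}(X)=\bigcap\{D(\psi)\mid X\subseteq D(\psi)\}$, and $\mathcal C=\{X\mid X=\mathrm{cl}(X)\}$. On $\mathcal C$: $\mathsf{emp}=\mathrm{cl}(\{\varnothing_m\})$, $\top=\mathrm{Bunch}$, $\bot=\mathrm{cl}(\emptyset)$, $X\vee Y=\mathrm{cl}(X\cup Y)$, $X\wedge Y=X\cap Y$, $X*Y=\mathrm{cl}(\{(\Delta,\Delta')\mid\Delta\in X,\Delta'\in Y\})$, $X\mathrel{ -\!\!*}Y=\{\Delta\mid\forall\Delta'\in X.\ (\Delta,\Delta')\in Y\}$, $X\to Y=\{\Delta\mid\forall\Delta'\in X.\ (\Delta;\Delta')\in Y\}$. $[\![\varphi]\!]\in\mathcal C$ is the homomorphic interpretation of $\varphi$ via these operations, with atoms interpreted as $[\![a]\!]=D(a)$. -}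

module Defs where

open import Data.Nat using (ℕ)
open import Data.Product using (Σ; ∃; _×_; _,_)
open import Data.Sum using (_⊎_)
open import Data.Empty using (⊥)
open import Data.Unit using (⊤)
open import Relation.Binary.PropositionalEquality using (_≡_)

Atom : Set
Atom = ℕ

infixr 30 _∗_ _−∗_
infixr 25 _∧_ _∨_
infixr 20 _⇒_

data Formula : Set where
  ⊤f ⊥f emp : Formula
  _∧_ _∨_ _⇒_ _∗_ _−∗_ : Formula → Formula → Formula
  atom : Atom → Formula

-- Bunches (raw syntax; equivalence is handled by _≈_ below)
data Bunch : Set where
  leaf : Formula → Bunch
  ∅m ∅a : Bunch
  _,,_ _︔_ : Bunch → Bunch → Bunch

data Ctx : Set where
  hole : Ctx
  _,,ˡ_ : Ctx → Bunch → Ctx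
  _,,ʳ_ : Bunch → Ctx → Ctx
  _︔ˡ_ : Ctx → Bunch → Ctx
  _︔ʳ_ : Bunch → Ctx → Ctx

_[_] : Ctx → Bunch → Bunch
hole [ Γ ] = Γ
(C ,,ˡ Δ) [ Γ ] = (C [ Γ ]) ,, Δ
(Δ ,,ʳ C) [ Γ ] = Δ ,, (C [ Γ ])
(C ︔ˡ Δ) [ Γ ] = (C [ Γ ]) ︔ Δ
(Δ ︔ʳ C) [ Γ ] = Δ ︔ (C [ Γ ])

infix 4 _≈_
data _≈_ : Bunch → Bunch → Set where
  ≈-refl  : ∀ {Δ} → Δ ≈ Δ
  ≈-sym   : ∀ {Δ Δ'} → Δ ≈ Δ' → Δ' ≈ Δ
  ≈-trans : ∀ {Δ₁ Δ₂ Δ₃} → Δ₁ ≈ Δ₂ → Δ₂ ≈ Δ₃ → Δ₁ ≈ Δ₃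
  ≈-ctx   : ∀ C {Γ Γ'} → Γ ≈ Γ' → C [ Γ ] ≈ C [ Γ' ]
  ,-comm  : ∀ {Δ₁ Δ₂} → (Δ₁ ,, Δ₂) ≈ (Δ₂ ,, Δ₁)
  ,-assoc : ∀ {Δ₁ Δ₂ Δ₃} → ((Δ₁ ,, Δ₂) ,, Δ₃) ≈ (Δ₁ ,, (Δ₂ ,, Δ₃))
  ,-unit  : ∀ {Δ} → (Δ ,, ∅m) ≈ Δ
  ︔-comm  : ∀ {Δ₁ Δ₂} → (Δ₁ ︔ Δ₂) ≈ (Δ₂ ︔ Δ₁)
  ︔-assoc : ∀ {Δ₁ Δ₂ Δ₃} → ((Δ₁ ︔ Δ₂) ︔ Δ₃) ≈ (Δ₁ ︔ (Δ₂ ︔ Δ₃))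
  ︔-unit  : ∀ {Δ} → (Δ ︔ ∅a) ≈ Δ

-- Cut-free BI sequent calculus:  Δ ⊢cf φ  (all rules except (cut))
infix 3 _⊢cf_
data _⊢cf_ : Bunch → Formula → Set where
  ax    : ∀ a → leaf (atom a) ⊢cf atom a
  equiv : ∀ {Δ Δ' φ} → Δ' ⊢cf φ → Δ ≈ Δ' → Δ ⊢cf φ
  W︔    : ∀ C {Δ₁ Δ₂ φ} → C [ Δ₁ ] ⊢cf φ → C [ Δ₁ ︔ Δ₂ ] ⊢cf φ
  C︔    : ∀ C {Δ₁ φ} → C [ Δ₁ ︔ Δ₁ ] ⊢cf φ → C [ Δ₁ ] ⊢cf φ
  empR  : ∅m ⊢cf emp
  empL  : ∀ C {φ} → C [ ∅m ] ⊢cf φ → C [ leaf emp ] ⊢cf φ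
  ∗R    : ∀ {Δ₁ Δ₂ φ ψ} → Δ₁ ⊢cf φ → Δ₂ ⊢cf ψ → (Δ₁ ,, Δ₂) ⊢cf φ ∗ ψ
  ∗L    : ∀ C {φ ψ χ} → C [ leaf φ ,, leaf ψ ] ⊢cf χ → C [ leaf (φ ∗ ψ) ] ⊢cf χ
  −∗R   : ∀ {Δ φ ψ} → (Δ ,, leaf φ) ⊢cf ψ → Δ ⊢cf φ −∗ ψ
  −∗L   : ∀ C {Δ₁ Δ₂ φ ψ χ} → Δ₁ ⊢cf φ → C [ Δ₂ ,, leaf ψ ] ⊢cf χ →
          C [ (Δ₁ ,, Δ₂) ,, leaf (φ −∗ ψ) ] ⊢cf χ
  ⊤R    : ∅a ⊢cf ⊤f
  ⊤L    : ∀ C {φ} → C [ ∅a ] ⊢cf φ → C [ leaf ⊤f ] ⊢cf φ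
  ∧R    : ∀ {Δ₁ Δ₂ φ ψ} → Δ₁ ⊢cf φ → Δ₂ ⊢cf ψ → (Δ₁ ︔ Δ₂) ⊢cf φ ∧ ψ
  ∧L    : ∀ C {φ ψ χ} → C [ leaf φ ︔ leaf ψ ] ⊢cf χ → C [ leaf (φ ∧ ψ) ] ⊢cf χ
  ⇒R    : ∀ {Δ φ ψ} → (Δ ︔ leaf φ) ⊢cf ψ → Δ ⊢cf φ ⇒ ψ
  ⇒L    : ∀ C {Δ₁ Δ₂ φ ψ χ} → Δ₁ ⊢cf φ → C [ Δ₂ ︔ leaf ψ ] ⊢cf χ →
          C [ (Δ₁ ︔ Δ₂) ︔ leaf (φ ⇒ ψ) ] ⊢cf χ
  ⊥L    : ∀ C {φ} → C [ leaf ⊥f ] ⊢cf φ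
  ∨R₁   : ∀ {Δ φ ψ} → Δ ⊢cf φ → Δ ⊢cf φ ∨ ψ
  ∨R₂   : ∀ {Δ φ ψ} → Δ ⊢cf ψ → Δ ⊢cf φ ∨ ψ
  ∨L    : ∀ C {φ ψ χ} → C [ leaf φ ] ⊢cf χ → C [ leaf ψ ] ⊢cf χ →
          C [ leaf (φ ∨ ψ) ] ⊢cf χ

BSet : Set₁
BSet = Bunch → Set

_⊆_ : BSet → BSet → Set
X ⊆ Y = ∀ {Δ} → X Δ → Y Δ

D : Formula → BSet
D φ Δ = Δ ⊢cf φ

cl : BSet → BSet
cl X Δ = ∀ ψ → X ⊆ D ψ → D ψ Δ

empS ⊤S ⊥S : BSet
empS = cl (λ Δ → Δ ≡ ∅m)
⊤S _ = ⊤
⊥S = cl (λ _ → ⊥)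

_∨S_ _∧S_ _∗S_ _−∗S_ _⇒S_ : BSet → BSet → BSet
(X ∨S Y) = cl (λ Δ → X Δ ⊎ Y Δ)
(X ∧S Y) Δ = X Δ × Y Δ
(X ∗S Y) = cl (λ Γ → Σ Bunch λ Δ → Σ Bunch λ Δ' → X Δ × Y Δ' × Γ ≡ (Δ ,, Δ'))
(X −∗S Y) Δ = ∀ {Δ'} → X Δ' → Y (Δ ,, Δ')
(X ⇒S Y) Δ = ∀ {Δ'} → X Δ' → Y (Δ ︔ Δ')

⟦_⟧ : Formula → BSet
⟦ ⊤f ⟧ = ⊤S
⟦ ⊥f ⟧ = ⊥S
⟦ emp ⟧ = empS
⟦ φ ∧ ψ ⟧ = ⟦ φ ⟧ ∧S ⟦ ψ ⟧
⟦ φ ∨ ψ ⟧ = ⟦ φ ⟧ ∨S ⟦ ψ ⟧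
⟦ φ ⇒ ψ ⟧ = ⟦ φ ⟧ ⇒S ⟦ ψ ⟧
⟦ φ ∗ ψ ⟧ = ⟦ φ ⟧ ∗S ⟦ ψ ⟧
⟦ φ −∗ ψ ⟧ = ⟦ φ ⟧ −∗S ⟦ ψ ⟧
⟦ atom a ⟧ = D (atom a)

-- Every set ⟦ φ ⟧ is closed under the goal-preserving left rules (bunch
-- equivalence, weakening, ∧L, −∗L, ⇒L): the closed sets are intersections of
-- sets D χ, and the implication-like operations inherit the closure from
-- their codomain. Both claims are then proved together by induction on φ: the
-- left rules put leaf φ into ⟦ φ ⟧, and the right rules give ⟦ φ ⟧ ⊆ D φ,
-- where the implications use leaf φ ∈ ⟦ φ ⟧ for the argument.
module Submission where

open import Defs
open import Data.Product using (_×_; _,_)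
open import Data.Sum using (inj₁; inj₂)
open import Data.Unit using (tt)
open import Relation.Binary.PropositionalEquality using (refl)

infix 4 _⊲_

-- Δ ⊲ Δ' : Δ is the conclusion of a left rule with premise Δ' and side
-- premises already derived; hence Δ' ⊢cf χ implies Δ ⊢cf χ for every χ.
data _⊲_ : Bunch → Bunch → Set where
  ≈-step  : ∀ {Δ Δ'} → Δ ≈ Δ' → Δ ⊲ Δ'
  W-step  : ∀ C {Δ₁ Δ₂} → C [ Δ₁ ︔ Δ₂ ] ⊲ C [ Δ₁ ]
  ∧L-step : ∀ C {φ ψ} → C [ leaf (φ ∧ ψ) ] ⊲ C [ leaf φ ︔ leaf ψ ]
  −∗L-step : ∀ C {Δ₁ Δ₂ φ ψ} → Δ₁ ⊢cf φ →
             C [ (Δ₁ ,, Δ₂) ,, leaf (φ −∗ ψ) ] ⊲ C [ Δ₂ ,, leaf ψ ]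
  ⇒L-step : ∀ C {Δ₁ Δ₂ φ ψ} → Δ₁ ⊢cf φ →
             C [ (Δ₁ ︔ Δ₂) ︔ leaf (φ ⇒ ψ) ] ⊲ C [ Δ₂ ︔ leaf ψ ]

⊲-,,ʳ : ∀ {Δ Δ'} Γ → Δ ⊲ Δ' → (Δ ,, Γ) ⊲ (Δ' ,, Γ)
⊲-,,ʳ Γ (≈-step e)       = ≈-step (≈-ctx (hole ,,ˡ Γ) e)
⊲-,,ʳ Γ (W-step C)       = W-step (C ,,ˡ Γ)
⊲-,,ʳ Γ (∧L-step C)      = ∧L-step (C ,,ˡ Γ)
⊲-,,ʳ Γ (−∗L-step C d)   = −∗L-step (C ,,ˡ Γ) d
⊲-,,ʳ Γ (⇒L-step C d)    = ⇒L-step (C ,,ˡ Γ) d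

⊲-︔ʳ : ∀ {Δ Δ'} Γ → Δ ⊲ Δ' → (Δ ︔ Γ) ⊲ (Δ' ︔ Γ)
⊲-︔ʳ Γ (≈-step e)       = ≈-step (≈-ctx (hole ︔ˡ Γ) e)
⊲-︔ʳ Γ (W-step C)       = W-step (C ︔ˡ Γ)
⊲-︔ʳ Γ (∧L-step C)      = ∧L-step (C ︔ˡ Γ)
⊲-︔ʳ Γ (−∗L-step C d)   = −∗L-step (C ︔ˡ Γ) d
⊲-︔ʳ Γ (⇒L-step C d)    = ⇒L-step (C ︔ˡ Γ) d

LeftClosed : BSet → Set
LeftClosed X = ∀ {Δ Δ'} → Δ ⊲ Δ' → X Δ' → X Δ

D-leftClosed : ∀ χ → LeftClosed (D χ)
D-leftClosed χ (≈-step e)     d = equiv d e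
D-leftClosed χ (W-step C)     d = W︔ C d
D-leftClosed χ (∧L-step C)    d = ∧L C d
D-leftClosed χ (−∗L-step C a) d = −∗L C a d
D-leftClosed χ (⇒L-step C a)  d = ⇒L C a d

cl-leftClosed : ∀ X → LeftClosed (cl X)
cl-leftClosed X s h ψ X⊆Dψ = D-leftClosed ψ s (h ψ X⊆Dψ)

⊤S-leftClosed : LeftClosed ⊤S
⊤S-leftClosed _ _ = tt

∧S-leftClosed : ∀ {X Y} → LeftClosed X → LeftClosed Y → LeftClosed (X ∧S Y)
∧S-leftClosed cX cY s (x , y) = cX s x , cY s y

−∗S-leftClosed : ∀ X {Y} → LeftClosed Y → LeftClosed (X −∗S Y)
−∗S-leftClosed X cY s h {Δ'} x = cY (⊲-,,ʳ Δ' s) (h x)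

⇒S-leftClosed : ∀ X {Y} → LeftClosed Y → LeftClosed (X ⇒S Y)
⇒S-leftClosed X cY s h {Δ'} x = cY (⊲-︔ʳ Δ' s) (h x)

⟦⟧-leftClosed : ∀ φ → LeftClosed ⟦ φ ⟧
⟦⟧-leftClosed ⊤f       = ⊤S-leftClosed
⟦⟧-leftClosed ⊥f       = cl-leftClosed _
⟦⟧-leftClosed emp      = cl-leftClosed _
⟦⟧-leftClosed (φ ∧ ψ)  = ∧S-leftClosed (⟦⟧-leftClosed φ) (⟦⟧-leftClosed ψ)
⟦⟧-leftClosed (φ ∨ ψ)  = cl-leftClosed _
⟦⟧-leftClosed (φ ⇒ ψ)  = ⇒S-leftClosed ⟦ φ ⟧ (⟦⟧-leftClosed ψ)
⟦⟧-leftClosed (φ ∗ ψ)  = cl-leftClosed _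
⟦⟧-leftClosed (φ −∗ ψ) = −∗S-leftClosed ⟦ φ ⟧ (⟦⟧-leftClosed ψ)
⟦⟧-leftClosed (atom a) = D-leftClosed (atom a)

cl⊆D : ∀ {X ψ} → X ⊆ D ψ → cl X ⊆ D ψ
cl⊆D {ψ = ψ} X⊆Dψ h = h ψ X⊆Dψ

⊢cf-⊤ : ∀ Δ → Δ ⊢cf ⊤f
⊢cf-⊤ Δ = equiv (W︔ hole ⊤R) (≈-trans (≈-sym ︔-unit) ︔-comm)

leaf∧∈∧S : ∀ {X Y φ ψ} → LeftClosed X → LeftClosed Y →
           X (leaf φ) → Y (leaf ψ) → (X ∧S Y) (leaf (φ ∧ ψ))
leaf∧∈∧S cX cY x y =
    cX (∧L-step hole) (cX (W-step hole) x)
  , cY (∧L-step hole) (cY (≈-step ︔-comm) (cY (W-step hole) y))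

∧S⊆D : ∀ {X Y φ ψ} → X ⊆ D φ → Y ⊆ D ψ → (X ∧S Y) ⊆ D (φ ∧ ψ)
∧S⊆D X⊆Dφ Y⊆Dψ (x , y) = C︔ hole (∧R (X⊆Dφ x) (Y⊆Dψ y))

-- The argument bunch Δ' plays the role of Δ₁ in −∗L, with Δ₂ = ∅m.
leaf−∗∈−∗S : ∀ {X Y φ ψ} → LeftClosed Y → X ⊆ D φ → Y (leaf ψ) →
             (X −∗S Y) (leaf (φ −∗ ψ))
leaf−∗∈−∗S cY X⊆Dφ y x =
  cY (≈-step (≈-trans ,-comm (≈-ctx (hole ,,ˡ _) (≈-sym ,-unit))))
     (cY (−∗L-step hole (X⊆Dφ x)) (cY (≈-step (≈-trans ,-comm ,-unit)) y))

leaf⇒∈⇒S : ∀ {X Y φ ψ} → LeftClosed Y → X ⊆ D φ → Y (leaf ψ) →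
           (X ⇒S Y) (leaf (φ ⇒ ψ))
leaf⇒∈⇒S cY X⊆Dφ y x =
  cY (≈-step (≈-trans ︔-comm (≈-ctx (hole ︔ˡ _) (≈-sym ︔-unit))))
     (cY (⇒L-step hole (X⊆Dφ x)) (cY (≈-step (≈-trans ︔-comm ︔-unit)) y))

−∗S⊆D : ∀ {X Y φ ψ} → X (leaf φ) → Y ⊆ D ψ → (X −∗S Y) ⊆ D (φ −∗ ψ)
−∗S⊆D x Y⊆Dψ h = −∗R (Y⊆Dψ (h x))

⇒S⊆D : ∀ {X Y φ ψ} → X (leaf φ) → Y ⊆ D ψ → (X ⇒S Y) ⊆ D (φ ⇒ ψ)
⇒S⊆D x Y⊆Dψ h = ⇒R (Y⊆Dψ (h x))

mutual
  leaf∈⟦⟧ : ∀ φ → ⟦ φ ⟧ (leaf φ)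
  leaf∈⟦⟧ ⊤f       = tt
  leaf∈⟦⟧ ⊥f       = λ _ _ → ⊥L hole
  leaf∈⟦⟧ emp      = λ _ s → empL hole (s refl)
  leaf∈⟦⟧ (φ ∧ ψ)  = leaf∧∈∧S (⟦⟧-leftClosed φ) (⟦⟧-leftClosed ψ) (leaf∈⟦⟧ φ) (leaf∈⟦⟧ ψ)
  leaf∈⟦⟧ (φ ∨ ψ)  = λ _ s → ∨L hole (s (inj₁ (leaf∈⟦⟧ φ))) (s (inj₂ (leaf∈⟦⟧ ψ)))
  leaf∈⟦⟧ (φ ⇒ ψ)  = leaf⇒∈⇒S (⟦⟧-leftClosed ψ) (⟦⟧⊆D φ) (leaf∈⟦⟧ ψ)
  leaf∈⟦⟧ (φ ∗ ψ)  = λ _ s → ∗L hole (s (leaf φ , leaf ψ , leaf∈⟦⟧ φ , leaf∈⟦⟧ ψ , refl))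
  leaf∈⟦⟧ (φ −∗ ψ) = leaf−∗∈−∗S (⟦⟧-leftClosed ψ) (⟦⟧⊆D φ) (leaf∈⟦⟧ ψ)
  leaf∈⟦⟧ (atom a) = ax a

  ⟦⟧⊆D : ∀ φ → ⟦ φ ⟧ ⊆ D φ
  ⟦⟧⊆D ⊤f       {Δ} _ = ⊢cf-⊤ Δ
  ⟦⟧⊆D ⊥f       = cl⊆D (λ ())
  ⟦⟧⊆D emp      = cl⊆D λ { refl → empR }
  ⟦⟧⊆D (φ ∧ ψ)  = ∧S⊆D (⟦⟧⊆D φ) (⟦⟧⊆D ψ)
  ⟦⟧⊆D (φ ∨ ψ)  = cl⊆D λ { (inj₁ x) → ∨R₁ (⟦⟧⊆D φ x) ; (inj₂ y) → ∨R₂ (⟦⟧⊆D ψ y) }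
  ⟦⟧⊆D (φ ⇒ ψ)  = ⇒S⊆D (leaf∈⟦⟧ φ) (⟦⟧⊆D ψ)
  ⟦⟧⊆D (φ ∗ ψ)  = cl⊆D λ { (_ , _ , x , y , refl) → ∗R (⟦⟧⊆D φ x) (⟦⟧⊆D ψ y) }
  ⟦⟧⊆D (φ −∗ ψ) = −∗S⊆D (leaf∈⟦⟧ φ) (⟦⟧⊆D ψ)
  ⟦⟧⊆D (atom a) = λ d → d

lemma6p6 : ∀ (φ : Formula) → ⟦ φ ⟧ (leaf φ) × (⟦ φ ⟧ ⊆ D φ)
lemma6p6 φ = leaf∈⟦⟧ φ , ⟦⟧⊆D φ
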